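{- For every $\epsilon>0$ and $s\in\mathbb{N}$ there exist $T,N\in\mathbb{N}$ with the following property: for every $n>N$ and every coloring $\Psi:E(K_n)\to\{R,B\}$ there exist a partition $V(K_n)=V_1\cup V_2\cup\dots\cup V_T$ into parts whose sizes differ by at most one, and colors $C_1,\dots,C_T\in\{R,B\}$, such that all but at most $\epsilon T$ of the sets $V_i$ are $(C_i,\epsilon,s)$-adequate.
   Context: Given a set $X$ of vertices in an edge-colored graph, a real $\epsilon>0$, a natural number $s$ and a color $C\in\{R,B\}$, $X$ is $(C,\epsilon,s)$-adequate if every subset of $X$ of size at least $\epsilon|X|$ contains a clique of size $s$ all of whose edges have color $C$.
   Formalization: The parameter ε ranges over the positive rationals rather than the positive reals. -}

module Defs where

open import Data.Nat using (ℕ)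
open import Data.Fin using (Fin)
open import Data.Fin.Subset using (Subset; _∈_; _⊆_; ∣_∣)
open import Data.Integer using (+_)
open import Data.Rational using (ℚ; _/_; _*_; _≤_)
open import Data.Product using (Σ; _×_)
open import Relation.Binary.PropositionalEquality using (_≡_; _≢_)

data Colour : Set where
  R B : Colour

ℕ→ℚ : ℕ → ℚ
ℕ→ℚ k = (+ k) / 1

-- An edge-colouring of K_n on vertex set Fin n, given as a symmetric
-- function on ordered pairs (its values on the diagonal are irrelevant).
record Colouring (n : ℕ) : Set where
  field
    col : Fin n → Fin n → Colour
    sym : ∀ u v → col u v ≡ col v u
open Colouring public

MonoClique : ∀ {n} → Colouring n → Colour → Subset n → Set
MonoClique Ψ C K = ∀ u v → u ∈ K → v ∈ K → u ≢ v → col Ψ u v ≡ C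

Adequate : ∀ {n} → Colouring n → Colour → ℚ → ℕ → Subset n → Set
Adequate {n} Ψ C ε s X =
  (Y : Subset n) → Y ⊆ X → ε * ℕ→ℚ ∣ X ∣ ≤ ℕ→ℚ ∣ Y ∣ →
  Σ (Subset n) λ K → K ⊆ Y × ∣ K ∣ ≡ s × MonoClique Ψ C K

IsPartition : ∀ {n T} → (Fin T → Subset n) → Set
IsPartition {n} {T} V =
  (∀ (v : Fin n) → Σ (Fin T) λ i → v ∈ V i) ×
  (∀ (v : Fin n) (i j : Fin T) → v ∈ V i → v ∈ V j → i ≡ j)

Equitable : ∀ {n T} → (Fin T → Subset n) → Set
Equitable {n} {T} V = ∀ (i j : Fin T) → ∣ V i ∣ Data.Nat.≤ Data.Nat.suc ∣ V j ∣

-- Fix q with ε ≥ 1/q and cut the vertex set greedily into T = 2q² parts of size ⌊n/T⌋ or ⌈n/T⌉.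
-- While the remaining set W satisfies q ℓ ≤ |W| for the next part size ℓ, some ℓ-subset of W is
-- adequate: pick q disjoint ℓ-subsets in turn; if none is red-adequate, each contains a set Y_i of
-- size ≥ ℓ/q without a red K_s, so by Ramsey (R(s,s) ≤ 4^s) every subset of ⋃ Y_i with more than
-- q·4^s vertices contains a blue K_s, and any ℓ-subset of ⋃ Y_i is blue-adequate once ℓ > q²·4^s.
-- When q ℓ > |W| fewer than 2q parts remain, and only these may be bad.
module Submission where

open import Defs renaming (sym to col-sym)
open import Data.Bool using (Bool; true; false)
open import Data.Empty using () renaming (⊥-elim to absurd)
open import Data.Fin as Fin using (Fin; zero; suc)
open import Data.Fin.Properties using (all?)
open import Data.Fin.Subset
open import Data.Fin.Subset.Properties
open import Data.Nat using (ℕ; zero; suc; _+_; _*_; _^_; _≤_; _<_; s≤s; z≤n; _≟_; _≤?_; NonZero)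
open import Data.Nat.Coprimality using (Coprime)
open import Data.Nat.DivMod using (_/_; _%_; m≡m%n+[m/n]*n; m%n<n; m*n/n≡m; /-monoˡ-≤)
open import Data.Nat.Properties
open import Data.Integer as ℤ using (+[1+_])
import Data.Integer.Properties as ℤ
open import Data.Rational as ℚ using (ℚ; mkℚ; Positive; toℚᵘ)
import Data.Rational.Properties as ℚ
open import Data.Rational.Unnormalised as ℚᵘ using (mkℚᵘ; *≤*)
import Data.Rational.Unnormalised.Properties as ℚᵘ
open import Data.Product using (Σ; _×_; _,_; proj₂)
open import Data.Sum as Sum using (_⊎_; inj₁; inj₂; [_,_]′)
open import Data.Vec using ([]; _∷_; tabulate; here; there)
open import Data.Vec.Properties using (lookup∘tabulate; []=⇒lookup; lookup⇒[]=)
open import Function using (_∘_; id)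
open import Relation.Binary.PropositionalEquality
open import Relation.Nullary using (¬_; Dec; yes; no)
open import Relation.Nullary.Decidable using (_×-dec_; _→-dec_; ¬?)

x∈p─q⇒x∉q : ∀ {n} (p q : Subset n) {x} → x ∈ p ─ q → x ∉ q
x∈p─q⇒x∉q (inside ∷ p)  (outside ∷ q) here       = λ ()
x∈p─q⇒x∉q (outside ∷ p) (inside ∷ q)  {zero} ()
x∈p─q⇒x∉q (outside ∷ p) (outside ∷ q) {zero} ()
x∈p─q⇒x∉q (_ ∷ p)       (_ ∷ q)       (there x∈) = x∈p─q⇒x∉q p q x∈ ∘ drop-there

x∈p⇒⁅x⁆⊆p : ∀ {n} {p : Subset n} {x} → x ∈ p → ⁅ x ⁆ ⊆ p
x∈p⇒⁅x⁆⊆p {p = p} x∈p y∈⁅x⁆ = subst (_∈ p) (sym (x∈⁅y⁆⇒x≡y _ y∈⁅x⁆)) x∈p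

∪-least : ∀ {n} {p q r : Subset n} → p ⊆ r → q ⊆ r → p ∪ q ⊆ r
∪-least {p = p} {q} p⊆r q⊆r x∈ = [ p⊆r , q⊆r ]′ (x∈p∪q⁻ p q x∈)

x∈p⇒0<∣p∣ : ∀ {n} {p : Subset n} {x} → x ∈ p → 0 < ∣ p ∣
x∈p⇒0<∣p∣ {x = x} x∈p = subst (_≤ _) (∣⁅x⁆∣≡1 x) (p⊆q⇒∣p∣≤∣q∣ (x∈p⇒⁅x⁆⊆p x∈p))

0<∣p∣⇒nonempty : ∀ {n} (p : Subset n) → 0 < ∣ p ∣ → Nonempty p
0<∣p∣⇒nonempty (inside ∷ p)  _ = zero , here
0<∣p∣⇒nonempty (outside ∷ p) 0<∣p∣ with 0<∣p∣⇒nonempty p 0<∣p∣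
... | x , x∈p = suc x , there x∈p

∣p∩q∣+∣p─q∣≡∣p∣ : ∀ {n} (p q : Subset n) → ∣ p ∩ q ∣ + ∣ p ─ q ∣ ≡ ∣ p ∣
∣p∩q∣+∣p─q∣≡∣p∣ []            []            = refl
∣p∩q∣+∣p─q∣≡∣p∣ (inside ∷ p)  (inside ∷ q)  = cong suc (∣p∩q∣+∣p─q∣≡∣p∣ p q)
∣p∩q∣+∣p─q∣≡∣p∣ (inside ∷ p)  (outside ∷ q) = trans (+-suc _ _) (cong suc (∣p∩q∣+∣p─q∣≡∣p∣ p q))
∣p∩q∣+∣p─q∣≡∣p∣ (outside ∷ p) (inside ∷ q)  = ∣p∩q∣+∣p─q∣≡∣p∣ p q
∣p∩q∣+∣p─q∣≡∣p∣ (outside ∷ p) (outside ∷ q) = ∣p∩q∣+∣p─q∣≡∣p∣ p q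

∣p─q∣+∣q∣≡∣p∣ : ∀ {n} (p q : Subset n) → q ⊆ p → ∣ p ─ q ∣ + ∣ q ∣ ≡ ∣ p ∣
∣p─q∣+∣q∣≡∣p∣ p q q⊆p = begin
  ∣ p ─ q ∣ + ∣ q ∣     ≡⟨ +-comm ∣ p ─ q ∣ ∣ q ∣ ⟩
  ∣ q ∣ + ∣ p ─ q ∣     ≡⟨ cong (_+ ∣ p ─ q ∣) ∣q∣≡∣p∩q∣ ⟩
  ∣ p ∩ q ∣ + ∣ p ─ q ∣ ≡⟨ ∣p∩q∣+∣p─q∣≡∣p∣ p q ⟩
  ∣ p ∣                 ∎
  where
  open ≡-Reasoning
  ∣q∣≡∣p∩q∣ : ∣ q ∣ ≡ ∣ p ∩ q ∣
  ∣q∣≡∣p∩q∣ = ≤-antisym (p⊆q⇒∣p∣≤∣q∣ (λ x∈q → x∈p∩q⁺ (q⊆p x∈q , x∈q))) (∣p∩q∣≤∣q∣ p q)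

∣p∪q∣≡∣p∣+∣q∣ : ∀ {n} (p q : Subset n) → Empty (p ∩ q) → ∣ p ∪ q ∣ ≡ ∣ p ∣ + ∣ q ∣
∣p∪q∣≡∣p∣+∣q∣ []            []            _ = refl
∣p∪q∣≡∣p∣+∣q∣ (inside ∷ p)  (inside ∷ q)  p∩q-empty = absurd (p∩q-empty (zero , here))
∣p∪q∣≡∣p∣+∣q∣ (inside ∷ p)  (outside ∷ q) p∩q-empty =
  cong suc (∣p∪q∣≡∣p∣+∣q∣ p q (drop-∷-Empty p∩q-empty))
∣p∪q∣≡∣p∣+∣q∣ (outside ∷ p) (inside ∷ q)  p∩q-empty =
  trans (cong suc (∣p∪q∣≡∣p∣+∣q∣ p q (drop-∷-Empty p∩q-empty))) (sym (+-suc _ _))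
∣p∪q∣≡∣p∣+∣q∣ (outside ∷ p) (outside ∷ q) p∩q-empty = ∣p∪q∣≡∣p∣+∣q∣ p q (drop-∷-Empty p∩q-empty)

subsetOfSize : ∀ {n} k (p : Subset n) → k ≤ ∣ p ∣ → Σ (Subset n) λ q → q ⊆ p × ∣ q ∣ ≡ k
subsetOfSize {n} zero    p             _         = ⊥ , ⊥⊆ , ∣⊥∣≡0 n
subsetOfSize     (suc k) (inside ∷ p)  (s≤s k≤p) with subsetOfSize k p k≤p
... | q , q⊆p , ∣q∣≡k = inside ∷ q , in⊆in q⊆p , cong suc ∣q∣≡k
subsetOfSize     (suc k) (outside ∷ p) k<p       with subsetOfSize (suc k) p k<p
... | q , q⊆p , ∣q∣≡k = outside ∷ q , out⊆ q⊆p , ∣q∣≡k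

pigeonhole : ∀ m x y → m + m ≤ suc (x + y) → m ≤ x ⊎ m ≤ y
pigeonhole m x y m+m≤ with m ≤? x
... | yes m≤x = inj₁ m≤x
... | no  m≰x = inj₂ (+-cancelˡ-≤ m m y (≤-trans m+m≤ (+-monoˡ-≤ y (≰⇒> m≰x))))

_≟ᶜ_ : (C D : Colour) → Dec (C ≡ D)
R ≟ᶜ R = yes refl
R ≟ᶜ B = no λ ()
B ≟ᶜ R = no λ ()
B ≟ᶜ B = yes refl

isRed : Colour → Bool
isRed R = true
isRed B = false

module _ {n : ℕ} (Ψ : Colouring n) where

  HasMonoClique : Colour → ℕ → Subset n → Set
  HasMonoClique C k Y = Σ (Subset n) λ K → K ⊆ Y × ∣ K ∣ ≡ k × MonoClique Ψ C K

  monoClique? : ∀ C K → Dec (MonoClique Ψ C K)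
  monoClique? C K = all? λ u → all? λ v →
    (u ∈? K) →-dec (v ∈? K) →-dec ¬? (u Fin.≟ v) →-dec (col Ψ u v ≟ᶜ C)

  hasMonoClique? : ∀ C k Y → Dec (HasMonoClique C k Y)
  hasMonoClique? C k Y = anySubset? λ K → (K ⊆? Y) ×-dec (∣ K ∣ ≟ k) ×-dec monoClique? C K

  hasMonoClique-mono : ∀ {C k Y Z} → Y ⊆ Z → HasMonoClique C k Y → HasMonoClique C k Z
  hasMonoClique-mono Y⊆Z (K , K⊆Y , ∣K∣≡k , mono) = K , ⊆-trans K⊆Y Y⊆Z , ∣K∣≡k , mono

  hasMonoClique-0 : ∀ C Y → HasMonoClique C 0 Y
  hasMonoClique-0 C Y = ⊥ , ⊥⊆ , ∣⊥∣≡0 n , λ u v u∈⊥ → absurd (∉⊥ u∈⊥)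

  hasMonoClique-cone : ∀ {C k Y Z v} → v ∈ Y → Z ⊆ Y - v → (∀ {u} → u ∈ Z → col Ψ v u ≡ C) →
                       HasMonoClique C k Z → HasMonoClique C (suc k) Y
  hasMonoClique-cone {C} {k} {Y} {Z} {v} v∈Y Z⊆Y-v vZ≡C (K , K⊆Z , ∣K∣≡k , mono) =
    K ∪ ⁅ v ⁆ , K∪v⊆Y , ∣K∪v∣≡1+k , mono′
    where
    v≡ : ∀ {u} → u ∈ ⁅ v ⁆ → u ≡ v
    v≡ = x∈⁅y⁆⇒x≡y v
    K⊆Y : K ⊆ Y
    K⊆Y = ⊆-trans K⊆Z (⊆-trans Z⊆Y-v (p─q⊆p Y ⁅ v ⁆))
    K∪v⊆Y : K ∪ ⁅ v ⁆ ⊆ Y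
    K∪v⊆Y = ∪-least K⊆Y (x∈p⇒⁅x⁆⊆p v∈Y)
    v∉K : Empty (K ∩ ⁅ v ⁆)
    v∉K (u , u∈) with x∈p∩q⁻ K ⁅ v ⁆ u∈
    ... | u∈K , u∈v = x∈p─q⇒x∉q Y ⁅ v ⁆ (Z⊆Y-v (K⊆Z u∈K)) u∈v
    ∣K∪v∣≡1+k : ∣ K ∪ ⁅ v ⁆ ∣ ≡ suc k
    ∣K∪v∣≡1+k = trans (∣p∪q∣≡∣p∣+∣q∣ K ⁅ v ⁆ v∉K) (trans (cong₂ _+_ ∣K∣≡k (∣⁅x⁆∣≡1 v)) (+-comm k 1))
    mono′ : MonoClique Ψ C (K ∪ ⁅ v ⁆)
    mono′ u w u∈ w∈ u≢w with x∈p∪q⁻ K ⁅ v ⁆ u∈ | x∈p∪q⁻ K ⁅ v ⁆ w∈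
    ... | inj₁ u∈K | inj₁ w∈K = mono u w u∈K w∈K u≢w
    ... | inj₁ u∈K | inj₂ w≡v rewrite v≡ w≡v = trans (col-sym Ψ u v) (vZ≡C (K⊆Z u∈K))
    ... | inj₂ u≡v | inj₁ w∈K rewrite v≡ u≡v = vZ≡C (K⊆Z w∈K)
    ... | inj₂ u≡v | inj₂ w≡v = absurd (u≢w (trans (v≡ u≡v) (sym (v≡ w≡v))))

  redNbhd : Fin n → Subset n
  redNbhd v = tabulate (isRed ∘ col Ψ v)

  ∈redNbhd⇒red : ∀ {v u} → u ∈ redNbhd v → col Ψ v u ≡ R
  ∈redNbhd⇒red {v} {u} u∈
    with col Ψ v u | trans (sym (lookup∘tabulate (isRed ∘ col Ψ v) u)) ([]=⇒lookup u∈)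
  ... | R | _  = refl
  ... | B | ()

  ∉redNbhd⇒blue : ∀ {v u} → u ∉ redNbhd v → col Ψ v u ≡ B
  ∉redNbhd⇒blue {v} {u} u∉ with col Ψ v u in eq
  ... | R = absurd (u∉ (lookup⇒[]= u _ (trans (lookup∘tabulate _ u) (cong isRed eq))))
  ... | B = refl

  -- Erdős–Szekeres: split Y - v into the red and blue neighbourhoods of v.
  ramsey : ∀ a b (Y : Subset n) → 2 ^ (a + b) ≤ ∣ Y ∣ → HasMonoClique R a Y ⊎ HasMonoClique B b Y
  ramsey zero    b       Y _ = inj₁ (hasMonoClique-0 R Y)
  ramsey (suc a) zero    Y _ = inj₂ (hasMonoClique-0 B Y)
  ramsey (suc a) (suc b) Y 2^≤∣Y∣ =
    grow (0<∣p∣⇒nonempty Y (≤-trans (m^n>0 2 (suc a + suc b)) 2^≤∣Y∣))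
    where
    M = 2 ^ (a + suc b)
    grow : Nonempty Y → HasMonoClique R (suc a) Y ⊎ HasMonoClique B (suc b) Y
    grow (v , v∈Y) = [ viaRed , viaBlue ]′ (pigeonhole M ∣ Red ∣ ∣ Blue ∣ M+M≤)
      where
      Red = (Y - v) ∩ redNbhd v
      Blue = (Y - v) ─ redNbhd v
      M+M≤ : M + M ≤ suc (∣ Red ∣ + ∣ Blue ∣)
      M+M≤ = begin
        M + M                       ≡⟨ cong (M +_) (sym (+-identityʳ M)) ⟩
        2 ^ (suc a + suc b)         ≤⟨ 2^≤∣Y∣ ⟩
        ∣ Y ∣                       ≡⟨ sym (∣p─q∣+∣q∣≡∣p∣ Y ⁅ v ⁆ (x∈p⇒⁅x⁆⊆p v∈Y)) ⟩
        ∣ Y - v ∣ + ∣ ⁅ v ⁆ ∣       ≡⟨ cong₂ _+_ (sym (∣p∩q∣+∣p─q∣≡∣p∣ (Y - v) (redNbhd v))) (∣⁅x⁆∣≡1 v) ⟩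
        ∣ Red ∣ + ∣ Blue ∣ + 1      ≡⟨ +-comm _ 1 ⟩
        suc (∣ Red ∣ + ∣ Blue ∣)    ∎
        where open ≤-Reasoning
      viaRed : M ≤ ∣ Red ∣ → HasMonoClique R (suc a) Y ⊎ HasMonoClique B (suc b) Y
      viaRed M≤∣Red∣ = [ (λ red → inj₁ (hasMonoClique-cone v∈Y (p∩q⊆p _ _) Red-red red))
                       , (λ blue → inj₂ (hasMonoClique-mono (⊆-trans (p∩q⊆p _ _) (p─q⊆p Y ⁅ v ⁆)) blue))
                       ]′ (ramsey a (suc b) Red M≤∣Red∣)
        where
        Red-red : ∀ {u} → u ∈ Red → col Ψ v u ≡ R
        Red-red u∈ = ∈redNbhd⇒red (proj₂ (x∈p∩q⁻ _ _ u∈))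
      viaBlue : M ≤ ∣ Blue ∣ → HasMonoClique R (suc a) Y ⊎ HasMonoClique B (suc b) Y
      viaBlue M≤∣Blue∣ = [ (λ red → inj₁ (hasMonoClique-mono (⊆-trans (p─q⊆p _ _) (p─q⊆p Y ⁅ v ⁆)) red))
                         , (λ blue → inj₂ (hasMonoClique-cone v∈Y (p─q⊆p _ _) Blue-blue blue))
                         ]′ (ramsey (suc a) b Blue (subst (_≤ ∣ Blue ∣) (cong (2 ^_) (+-suc a b)) M≤∣Blue∣))
        where
        Blue-blue : ∀ {u} → u ∈ Blue → col Ψ v u ≡ B
        Blue-blue u∈ = ∉redNbhd⇒blue (x∈p─q⇒x∉q _ _ u∈)

  -- (C, 1/q, s)-adequacy, with the condition |Y| ≥ |X|/q cleared of its denominator.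
  AdequateRecip : Colour → ℕ → ℕ → Subset n → Set
  AdequateRecip C q s X = ∀ Y → Y ⊆ X → ∣ X ∣ ≤ q * ∣ Y ∣ → HasMonoClique C s Y

  adequate⊎counterexample : ∀ C q s X →
    AdequateRecip C q s X ⊎ Σ (Subset n) λ Y → Y ⊆ X × ∣ X ∣ ≤ q * ∣ Y ∣ × ¬ HasMonoClique C s Y
  adequate⊎counterexample C q s X
    with anySubset? (λ Y → (Y ⊆? X) ×-dec (∣ X ∣ ≤? q * ∣ Y ∣) ×-dec ¬? (hasMonoClique? C s Y))
  ... | yes counterexample = inj₂ counterexample
  ... | no ¬counterexample = inj₁ adequate
    where
    adequate : AdequateRecip C q s X
    adequate Y Y⊆X ∣X∣≤q∣Y∣ with hasMonoClique? C s Y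
    ... | yes clique   = clique
    ... | no ¬clique = absurd (¬counterexample (Y , Y⊆X , ∣X∣≤q∣Y∣ , ¬clique))

  BlueRich : ℕ → ℕ → Subset n → Set
  BlueRich s c A = ∀ Z → Z ⊆ A → c * 2 ^ (s + s) < ∣ Z ∣ → HasMonoClique B s Z

  blueRich-⊥ : ∀ s → BlueRich s 0 ⊥
  blueRich-⊥ s Z Z⊆⊥ 0<∣Z∣ = absurd (<⇒≱ 0<∣Z∣ (subst (∣ Z ∣ ≤_) (∣⊥∣≡0 n) (p⊆q⇒∣p∣≤∣q∣ Z⊆⊥)))

  -- If Z meets the red-K_s-free Y in 4^s vertices, Ramsey gives a blue K_s there; otherwise Z ─ Y is
  -- large enough inside A.
  blueRich-∪ : ∀ {s c A Y} → BlueRich s c A → ¬ HasMonoClique R s Y → BlueRich s (suc c) (A ∪ Y)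
  blueRich-∪ {s} {c} {A} {Y} rich redFree Z Z⊆A∪Y big with 2 ^ (s + s) ≤? ∣ Z ∩ Y ∣
  ... | yes r≤∣Z∩Y∣ = [ (λ red → absurd (redFree (hasMonoClique-mono (p∩q⊆q Z Y) red)))
                      , hasMonoClique-mono (p∩q⊆p Z Y)
                      ]′ (ramsey s s (Z ∩ Y) r≤∣Z∩Y∣)
  ... | no r≰∣Z∩Y∣ = hasMonoClique-mono (p─q⊆p Z Y) (rich (Z ─ Y) Z─Y⊆A big′)
    where
    r = 2 ^ (s + s)
    Z─Y⊆A : Z ─ Y ⊆ A
    Z─Y⊆A x∈ = [ id , (λ x∈Y → absurd (x∈p─q⇒x∉q Z Y x∈ x∈Y)) ]′
                 (x∈p∪q⁻ A Y (Z⊆A∪Y (p─q⊆p Z Y x∈)))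
    big′ : c * r < ∣ Z ─ Y ∣
    big′ = +-cancelˡ-≤ r _ _ (begin
      r + suc (c * r)         ≡⟨ +-suc r (c * r) ⟩
      suc (suc c * r)         ≤⟨ big ⟩
      ∣ Z ∣                   ≡⟨ sym (∣p∩q∣+∣p─q∣≡∣p∣ Z Y) ⟩
      ∣ Z ∩ Y ∣ + ∣ Z ─ Y ∣   ≤⟨ +-monoˡ-≤ _ (<⇒≤ (≰⇒> r≰∣Z∩Y∣)) ⟩
      r + ∣ Z ─ Y ∣           ∎)
      where open ≤-Reasoning

  redAdequate⊎blueRich : ∀ q s ℓ k W → k * ℓ ≤ ∣ W ∣ →
    (Σ (Subset n) λ X → X ⊆ W × ∣ X ∣ ≡ ℓ × AdequateRecip R q s X) ⊎
    (Σ (Subset n) λ A → A ⊆ W × k * ℓ ≤ q * ∣ A ∣ × BlueRich s k A)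
  redAdequate⊎blueRich q s ℓ zero    W _ = inj₂ (⊥ , ⊥⊆ , z≤n , blueRich-⊥ s)
  redAdequate⊎blueRich q s ℓ (suc k) W ℓ+kℓ≤∣W∣
    with subsetOfSize ℓ W (≤-trans (m≤m+n ℓ (k * ℓ)) ℓ+kℓ≤∣W∣)
  ... | X , X⊆W , ∣X∣≡ℓ with adequate⊎counterexample R q s X
  ...   | inj₁ adequate = inj₁ (X , X⊆W , ∣X∣≡ℓ , adequate)
  ...   | inj₂ (Y , Y⊆X , ∣X∣≤q∣Y∣ , redFree) =
    Sum.map inW addY (redAdequate⊎blueRich q s ℓ k (W ─ X) kℓ≤∣W─X∣)
    where
    W─X⊆W : W ─ X ⊆ W
    W─X⊆W = p─q⊆p W X
    kℓ≤∣W─X∣ : k * ℓ ≤ ∣ W ─ X ∣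
    kℓ≤∣W─X∣ = +-cancelʳ-≤ ℓ _ _ (begin
      k * ℓ + ℓ         ≡⟨ +-comm (k * ℓ) ℓ ⟩
      ℓ + k * ℓ         ≤⟨ ℓ+kℓ≤∣W∣ ⟩
      ∣ W ∣             ≡⟨ sym (∣p─q∣+∣q∣≡∣p∣ W X X⊆W) ⟩
      ∣ W ─ X ∣ + ∣ X ∣ ≡⟨ cong (∣ W ─ X ∣ +_) ∣X∣≡ℓ ⟩
      ∣ W ─ X ∣ + ℓ     ∎)
      where open ≤-Reasoning
    inW : Σ (Subset n) (λ X′ → X′ ⊆ W ─ X × ∣ X′ ∣ ≡ ℓ × AdequateRecip R q s X′) →
          Σ (Subset n) (λ X′ → X′ ⊆ W × ∣ X′ ∣ ≡ ℓ × AdequateRecip R q s X′)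
    inW (X′ , X′⊆W─X , ∣X′∣≡ℓ , adequate) = X′ , ⊆-trans X′⊆W─X W─X⊆W , ∣X′∣≡ℓ , adequate
    addY : Σ (Subset n) (λ A → A ⊆ W ─ X × k * ℓ ≤ q * ∣ A ∣ × BlueRich s k A) →
           Σ (Subset n) (λ A → A ⊆ W × suc k * ℓ ≤ q * ∣ A ∣ × BlueRich s (suc k) A)
    addY (A , A⊆W─X , kℓ≤q∣A∣ , rich) =
      A ∪ Y , ∪-least (⊆-trans A⊆W─X W─X⊆W) (⊆-trans Y⊆X X⊆W) , size , blueRich-∪ {c = k} rich redFree
      where
      A∩Y-empty : Empty (A ∩ Y)
      A∩Y-empty (x , x∈) with x∈p∩q⁻ A Y x∈
      ... | x∈A , x∈Y = x∈p─q⇒x∉q W X (A⊆W─X x∈A) (Y⊆X x∈Y)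
      size : suc k * ℓ ≤ q * ∣ A ∪ Y ∣
      size = begin
        ℓ + k * ℓ               ≤⟨ +-mono-≤ (subst (_≤ q * ∣ Y ∣) ∣X∣≡ℓ ∣X∣≤q∣Y∣) kℓ≤q∣A∣ ⟩
        q * ∣ Y ∣ + q * ∣ A ∣   ≡⟨ sym (*-distribˡ-+ q ∣ Y ∣ ∣ A ∣) ⟩
        q * (∣ Y ∣ + ∣ A ∣)     ≡⟨ cong (q *_) (+-comm ∣ Y ∣ ∣ A ∣) ⟩
        q * (∣ A ∣ + ∣ Y ∣)     ≡⟨ cong (q *_) (sym (∣p∪q∣≡∣p∣+∣q∣ A Y A∩Y-empty)) ⟩
        q * ∣ A ∪ Y ∣           ∎
        where open ≤-Reasoning

  adequateBlock : ∀ q s ℓ .{{_ : NonZero q}} (W : Subset n) → q * q * 2 ^ (s + s) < ℓ → q * ℓ ≤ ∣ W ∣ →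
    Σ (Subset n) λ X → X ⊆ W × ∣ X ∣ ≡ ℓ × Σ Colour λ C → AdequateRecip C q s X
  adequateBlock q s ℓ W big qℓ≤∣W∣ with redAdequate⊎blueRich q s ℓ q W qℓ≤∣W∣
  ... | inj₁ (X , X⊆W , ∣X∣≡ℓ , adequate) = X , X⊆W , ∣X∣≡ℓ , R , adequate
  ... | inj₂ (A , A⊆W , qℓ≤q∣A∣ , rich) with subsetOfSize ℓ A (*-cancelˡ-≤ q qℓ≤q∣A∣)
  ...   | X , X⊆A , ∣X∣≡ℓ = X , ⊆-trans X⊆A A⊆W , ∣X∣≡ℓ , B , adequate
    where
    adequate : AdequateRecip B q s X
    adequate Y Y⊆X ∣X∣≤q∣Y∣ = rich Y (⊆-trans Y⊆X X⊆A) (*-cancelˡ-< q _ _ (begin-strict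
      q * (q * 2 ^ (s + s)) ≡⟨ sym (*-assoc q q _) ⟩
      q * q * 2 ^ (s + s)   <⟨ big ⟩
      ℓ                     ≡⟨ sym ∣X∣≡ℓ ⟩
      ∣ X ∣                 ≤⟨ ∣X∣≤q∣Y∣ ⟩
      q * ∣ Y ∣             ∎))
      where open ≤-Reasoning

Near : ℕ → ℕ → Set
Near m k = k ≡ m ⊎ k ≡ suc m

near⇒≤suc : ∀ {m x y} → Near m x → Near m y → x ≤ suc y
near⇒≤suc (inj₁ refl) (inj₁ refl) = n≤1+n _
near⇒≤suc (inj₁ refl) (inj₂ refl) = m≤n+m _ 2
near⇒≤suc (inj₂ refl) (inj₁ refl) = ≤-refl
near⇒≤suc (inj₂ refl) (inj₂ refl) = n≤1+n _

near⇒≥ : ∀ {m k} → Near m k → m ≤ k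
near⇒≥ (inj₁ refl) = ≤-refl
near⇒≥ (inj₂ refl) = n≤1+n _

near⇒≤1+m : ∀ {m k} → Near m k → k ≤ suc m
near⇒≤1+m nearK = near⇒≤suc nearK (inj₁ refl)

splitFirstPart : ∀ m j e → e ≤ suc j →
  Σ ℕ λ ℓ → Σ ℕ λ e′ → Near m ℓ × e′ ≤ j × suc j * m + e ≡ ℓ + (j * m + e′)
splitFirstPart m j zero    _         = m , 0 , inj₁ refl , z≤n , +-assoc m (j * m) 0
splitFirstPart m j (suc e) (s≤s e≤j) = suc m , e , inj₂ refl , e≤j ,
  trans (+-suc (m + j * m) e) (cong suc (+-assoc m (j * m) e))

fewPartsLeft : ∀ {m ℓ} k q → 0 < m → ℓ ≤ suc m → k * m < q * ℓ → k ≤ 2 * q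
fewPartsLeft {m} {ℓ} k q 0<m ℓ≤1+m km<qℓ = <⇒≤ (*-cancelʳ-< m k (2 * q) (begin-strict
  k * m                <⟨ km<qℓ ⟩
  q * ℓ                ≤⟨ *-monoʳ-≤ q (≤-trans ℓ≤1+m (+-monoˡ-≤ m 0<m)) ⟩
  q * (m + m)          ≡⟨ *-distribˡ-+ q m m ⟩
  q * m + q * m        ≡⟨ cong (q * m +_) (sym (+-identityʳ (q * m))) ⟩
  q * m + (q * m + 0)  ≡⟨ sym (*-assoc 2 q m) ⟩
  2 * q * m            ∎))
  where open ≤-Reasoning

module _ {n : ℕ} (m : ℕ) where

  record EquiPartition (j : ℕ) (W : Subset n) : Set where
    field
      part     : Fin j → Subset n
      part⊆    : ∀ i → part i ⊆ W
      cover    : ∀ {v} → v ∈ W → Σ (Fin j) λ i → v ∈ part i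
      disjoint : ∀ {v} i i′ → v ∈ part i → v ∈ part i′ → i ≡ i′
      near     : ∀ i → Near m ∣ part i ∣

  equiPartition-∅ : ∀ {W} → ∣ W ∣ ≡ 0 → EquiPartition 0 W
  equiPartition-∅ ∣W∣≡0 = record
    { part     = λ ()
    ; part⊆    = λ ()
    ; cover    = λ v∈W → absurd (<⇒≢ (x∈p⇒0<∣p∣ v∈W) (sym ∣W∣≡0))
    ; disjoint = λ ()
    ; near     = λ ()
    }

  equiPartition-∷ : ∀ {j W X} → X ⊆ W → Near m ∣ X ∣ → EquiPartition j (W ─ X) → EquiPartition (suc j) W
  equiPartition-∷ {j} {W} {X} X⊆W nearX P = record
    { part     = part′
    ; part⊆    = part′⊆
    ; cover    = cover′
    ; disjoint = disjoint′
    ; near     = λ { zero → nearX ; (suc i) → near i }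
    }
    where
    open EquiPartition P
    part′ : Fin (suc j) → Subset n
    part′ zero    = X
    part′ (suc i) = part i
    part′⊆ : ∀ i → part′ i ⊆ W
    part′⊆ zero    = X⊆W
    part′⊆ (suc i) = ⊆-trans (part⊆ i) (p─q⊆p W X)
    cover′ : ∀ {v} → v ∈ W → Σ (Fin (suc j)) λ i → v ∈ part′ i
    cover′ {v} v∈W with v ∈? X
    ... | yes v∈X = zero , v∈X
    ... | no  v∉X with cover (x∈p∧x∉q⇒x∈p─q v∈W v∉X)
    ...   | i , v∈ = suc i , v∈
    disjoint′ : ∀ {v} i i′ → v ∈ part′ i → v ∈ part′ i′ → i ≡ i′
    disjoint′ zero    zero     _  _   = refl
    disjoint′ zero    (suc i′) v∈ v∈′ = absurd (x∈p─q⇒x∉q W X (part⊆ i′ v∈′) v∈)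
    disjoint′ (suc i) zero     v∈ v∈′ = absurd (x∈p─q⇒x∉q W X (part⊆ i v∈) v∈′)
    disjoint′ (suc i) (suc i′) v∈ v∈′ = cong suc (disjoint i i′ v∈ v∈′)

module _ {n : ℕ} {L : Set} (Good : L → Subset n → Set) (default : L) (q m : ℕ) (0<m : 0 < m)
  (block : ∀ ℓ W → m ≤ ℓ → q * ℓ ≤ ∣ W ∣ → Σ (Subset n) λ X → X ⊆ W × ∣ X ∣ ≡ ℓ × Σ L λ c → Good c X)
  where

  record MostlyGoodPartition (j : ℕ) (W : Subset n) : Set where
    field
      partition : EquiPartition m j W
      label     : Fin j → L
      bad       : Subset j
      ∣bad∣≤2q  : ∣ bad ∣ ≤ 2 * q
      good      : ∀ i → i ∉ bad → Good (label i) (EquiPartition.part partition i)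

  private
    consGood : ∀ {j W X c} → X ⊆ W → Near m ∣ X ∣ → Good c X →
               MostlyGoodPartition j (W ─ X) → MostlyGoodPartition (suc j) W
    consGood {c = c} X⊆W nearX goodX P = record
      { partition = equiPartition-∷ m X⊆W nearX partition
      ; label     = λ { zero → c ; (suc i) → label i }
      ; bad       = outside ∷ bad
      ; ∣bad∣≤2q  = ∣bad∣≤2q
      ; good      = λ { zero _ → goodX ; (suc i) i∉ → good i (i∉ ∘ there) }
      }
      where open MostlyGoodPartition P

    consBad : ∀ {j W X} → X ⊆ W → Near m ∣ X ∣ → suc j ≤ 2 * q →
              MostlyGoodPartition j (W ─ X) → MostlyGoodPartition (suc j) W
    consBad {j} X⊆W nearX 1+j≤2q P = record
      { partition = equiPartition-∷ m X⊆W nearX partition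
      ; label     = λ { zero → default ; (suc i) → label i }
      ; bad       = inside ∷ bad
      ; ∣bad∣≤2q  = ≤-trans (s≤s (∣p∣≤n bad)) 1+j≤2q
      ; good      = λ { zero 0∉ → absurd (0∉ here) ; (suc i) i∉ → good i (i∉ ∘ there) }
      }
      where open MostlyGoodPartition P

  mostlyGoodPartition : ∀ j W e → e ≤ j → ∣ W ∣ ≡ j * m + e → MostlyGoodPartition j W
  mostlyGoodPartition zero W e e≤0 ∣W∣≡e = record
    { partition = equiPartition-∅ m (trans ∣W∣≡e (n≤0⇒n≡0 e≤0))
    ; label     = λ ()
    ; bad       = []
    ; ∣bad∣≤2q  = z≤n
    ; good      = λ ()
    }
  mostlyGoodPartition (suc j) W e e≤1+j ∣W∣≡ with splitFirstPart m j e e≤1+j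
  ... | ℓ , e′ , nearℓ , e′≤j , split = peel (q * ℓ ≤? ∣ W ∣)
    where
    ∣W∣≡ℓ+rest : ∣ W ∣ ≡ ℓ + (j * m + e′)
    ∣W∣≡ℓ+rest = trans ∣W∣≡ split
    rest : ∀ {X} → X ⊆ W → ∣ X ∣ ≡ ℓ → MostlyGoodPartition j (W ─ X)
    rest {X} X⊆W ∣X∣≡ℓ = mostlyGoodPartition j (W ─ X) e′ e′≤j (+-cancelʳ-≡ ∣ X ∣ _ _ (begin
      ∣ W ─ X ∣ + ∣ X ∣        ≡⟨ ∣p─q∣+∣q∣≡∣p∣ W X X⊆W ⟩
      ∣ W ∣                    ≡⟨ ∣W∣≡ℓ+rest ⟩
      ℓ + (j * m + e′)         ≡⟨ +-comm ℓ _ ⟩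
      j * m + e′ + ℓ           ≡⟨ cong (j * m + e′ +_) (sym ∣X∣≡ℓ) ⟩
      j * m + e′ + ∣ X ∣       ∎))
      where open ≡-Reasoning
    nearSize : ∀ X → ∣ X ∣ ≡ ℓ → Near m ∣ X ∣
    nearSize X ∣X∣≡ℓ = subst (Near m) (sym ∣X∣≡ℓ) nearℓ
    peel : Dec (q * ℓ ≤ ∣ W ∣) → MostlyGoodPartition (suc j) W
    peel (yes qℓ≤∣W∣) with block ℓ W (near⇒≥ nearℓ) qℓ≤∣W∣
    ... | X , X⊆W , ∣X∣≡ℓ , c , goodX = consGood X⊆W (nearSize X ∣X∣≡ℓ) goodX (rest X⊆W ∣X∣≡ℓ)
    peel (no qℓ≰∣W∣) with subsetOfSize ℓ W (subst (ℓ ≤_) (sym ∣W∣≡ℓ+rest) (m≤m+n ℓ _))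
    ... | X , X⊆W , ∣X∣≡ℓ = consBad X⊆W (nearSize X ∣X∣≡ℓ) 1+j≤2q (rest X⊆W ∣X∣≡ℓ)
      where
      1+j≤2q : suc j ≤ 2 * q
      1+j≤2q = fewPartsLeft (suc j) q 0<m (near⇒≤1+m nearℓ) (begin-strict
        suc j * m          ≤⟨ +-mono-≤ (near⇒≥ nearℓ) (m≤m+n (j * m) e′) ⟩
        ℓ + (j * m + e′)   ≡⟨ sym ∣W∣≡ℓ+rest ⟩
        ∣ W ∣              <⟨ ≰⇒> qℓ≰∣W∣ ⟩
        q * ℓ              ∎)
        where open ≤-Reasoning

MostlyAdequatePartition : ∀ {n} → Colouring n → (q s T : ℕ) → Set
MostlyAdequatePartition {n} Ψ q s T =
  Σ (Fin T → Subset n) λ V → Σ (Fin T → Colour) λ C →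
  IsPartition V × Equitable V ×
  Σ (Subset T) λ Bad → ∣ Bad ∣ * q ≤ T × (∀ i → i ∉ Bad → AdequateRecip Ψ (C i) q s (V i))

equitableAdequatePartition : ∀ q s .{{_ : NonZero q}} → Σ ℕ λ T → Σ ℕ λ N →
  ∀ n → N < n → (Ψ : Colouring n) → MostlyAdequatePartition Ψ q s T
equitableAdequatePartition q s = T , ℓ₀ * T , partitionOf
  where
  T = 2 * q * q
  ℓ₀ = suc (q * q * 2 ^ (s + s))
  instance
    2q≢0 : NonZero (2 * q)
    2q≢0 = m*n≢0 2 q
    T≢0 : NonZero T
    T≢0 = m*n≢0 (2 * q) q
  partitionOf : ∀ n → ℓ₀ * T < n → (Ψ : Colouring n) → MostlyAdequatePartition Ψ q s T
  partitionOf n N<n Ψ =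
    part , label , ((λ v → cover ∈⊤) , λ v → disjoint) , (λ i i′ → near⇒≤suc (near i) (near i′)) ,
    bad , *-monoˡ-≤ q ∣bad∣≤2q , good
    where
    m = n / T
    ℓ₀≤m : ℓ₀ ≤ m
    ℓ₀≤m = subst (_≤ m) (m*n/n≡m ℓ₀ T) (/-monoˡ-≤ T (<⇒≤ N<n))
    ∣⊤∣≡Tm+r : ∣ ⊤ {n} ∣ ≡ T * m + n % T
    ∣⊤∣≡Tm+r = begin
      ∣ ⊤ {n} ∣       ≡⟨ ∣⊤∣≡n n ⟩
      n               ≡⟨ m≡m%n+[m/n]*n n T ⟩
      n % T + m * T   ≡⟨ +-comm (n % T) _ ⟩
      m * T + n % T   ≡⟨ cong (_+ n % T) (*-comm m T) ⟩
      T * m + n % T   ∎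
      where open ≡-Reasoning
    block : ∀ ℓ W → m ≤ ℓ → q * ℓ ≤ ∣ W ∣ →
            Σ (Subset n) λ X → X ⊆ W × ∣ X ∣ ≡ ℓ × Σ Colour λ C → AdequateRecip Ψ C q s X
    block ℓ W m≤ℓ = adequateBlock Ψ q s ℓ W (≤-trans ℓ₀≤m m≤ℓ)
    open MostlyGoodPartition (mostlyGoodPartition (λ C → AdequateRecip Ψ C q s) R q m
      (≤-trans (s≤s z≤n) ℓ₀≤m) block T ⊤ (n % T) (<⇒≤ (m%n<n n T)) ∣⊤∣≡Tm+r)
    open EquiPartition partition

toℚᵘ-ℕ→ℚ : ∀ k → toℚᵘ (ℕ→ℚ k) ℚᵘ.≃ mkℚᵘ (ℤ.+ k) 0
toℚᵘ-ℕ→ℚ k = ℚ.toℚᵘ-fromℚᵘ (mkℚᵘ (ℤ.+ k) 0)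

module _ (a d : ℕ) .(c : Coprime (suc a) (suc d)) where

  private
    ε = mkℚ +[1+ a ] d c

    toℚᵘ-ε*ℕ→ℚ : ∀ k → toℚᵘ (ε ℚ.* ℕ→ℚ k) ℚᵘ.≃ mkℚᵘ +[1+ a ] d ℚᵘ.* mkℚᵘ (ℤ.+ k) 0
    toℚᵘ-ε*ℕ→ℚ k = ℚᵘ.≃-trans (ℚ.toℚᵘ-homo-* ε (ℕ→ℚ k)) (ℚᵘ.*-congˡ {mkℚᵘ +[1+ a ] d} (toℚᵘ-ℕ→ℚ k))

    numerator : ∀ x → (ℤ.sign (ℤ.+ 1) ℤ.◃ (suc a * x)) ℤ.* ℤ.+ 1 ≡ ℤ.+ (suc a * x)
    numerator x = trans (ℤ.*-identityʳ _) (ℤ.+◃n≡+n _)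

    denominator : ∀ y → ℤ.+ y ℤ.* ℤ.+ suc (d * 1) ≡ ℤ.+ (y * suc d)
    denominator y = trans (sym (ℤ.pos-* y (suc (d * 1)))) (cong (λ z → ℤ.+ (y * suc z)) (*-identityʳ d))

  ε*x≤y⇒x≤[1+d]y : ∀ x y → ε ℚ.* ℕ→ℚ x ℚ.≤ ℕ→ℚ y → x ≤ suc d * y
  ε*x≤y⇒x≤[1+d]y x y εx≤y
    with ℚᵘ.≤-respʳ-≃ (toℚᵘ-ℕ→ℚ y) (ℚᵘ.≤-respˡ-≃ (toℚᵘ-ε*ℕ→ℚ x) (ℚ.toℚᵘ-mono-≤ εx≤y))
  ... | *≤* cross = begin
    x               ≤⟨ m≤n*m x (suc a) ⟩
    suc a * x       ≤⟨ ℤ.drop‿+≤+ (subst₂ ℤ._≤_ (numerator x) (denominator y) cross) ⟩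
    y * suc d       ≡⟨ *-comm y (suc d) ⟩
    suc d * y       ∎
    where open ≤-Reasoning

  b[1+d]≤t⇒b≤ε*t : ∀ b t → b * suc d ≤ t → ℕ→ℚ b ℚ.≤ ε ℚ.* ℕ→ℚ t
  b[1+d]≤t⇒b≤ε*t b t b[1+d]≤t = ℚ.toℚᵘ-cancel-≤
    (ℚᵘ.≤-respˡ-≃ (ℚᵘ.≃-sym (toℚᵘ-ℕ→ℚ b)) (ℚᵘ.≤-respʳ-≃ (ℚᵘ.≃-sym (toℚᵘ-ε*ℕ→ℚ t))
      (*≤* (subst₂ ℤ._≤_ (sym (denominator b)) (sym (numerator t))
        (ℤ.+≤+ (≤-trans b[1+d]≤t (m≤n*m t (suc a))))))))

lemma2 : (ε : ℚ) → Positive ε → (s : ℕ) →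
    Σ ℕ λ T → Σ ℕ λ N →
    ∀ (n : ℕ) → N < n → (Ψ : Colouring n) →
    Σ (Fin T → Subset n) λ V → Σ (Fin T → Colour) λ C →
    IsPartition V × Equitable V ×
    Σ (Subset T) λ Bad →
    ℕ→ℚ ∣ Bad ∣ ℚ.≤ ε ℚ.* ℕ→ℚ T ×
    (∀ (i : Fin T) → i ∉ Bad → Adequate Ψ (C i) ε s (V i))
lemma2 (mkℚ +[1+ a ] d c) _ s =
  let T , N , partitionOf = equitableAdequatePartition (suc d) s in
  T , N , λ n N<n Ψ →
    let V , C , isPartition , equitable , Bad , ∣Bad∣q≤T , adequate = partitionOf n N<n Ψ in
    V , C , isPartition , equitable , Bad , b[1+d]≤t⇒b≤ε*t a d c ∣ Bad ∣ T ∣Bad∣q≤T ,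
    λ i i∉Bad Y Y⊆Vi ε∣Vi∣≤∣Y∣ → adequate i i∉Bad Y Y⊆Vi (ε*x≤y⇒x≤[1+d]y a d c _ _ ε∣Vi∣≤∣Y∣)
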